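{- For every natural number $n \geq 0$, $\bar{A}_{\bar{a}_n} = \mathcal{P}(\bar{A}_n)$, where $\bar a_n := |\bar A_n|$ and $\mathcal{P}$ denotes the power set.
   Context: The minimally bounded adjunctive hierarchy is defined by $\bar{A}_{ -1} := \emptyset$, $\bar{A}_0 := \{\emptyset\}$, and for $n \geq 0$, $\bar{A}_{n+1} := \{\emptyset\} \cup \{ x \cup \{y\} : x \in \bar{A}_n \text{ and there exists an integer } m \geq -1 \text{ with } \mathcal{P}(\bar{A}_m) \subseteq \bar{A}_n \text{ and } y \in \bar{A}_{m+1}\}$. -}

module Defs where

open import Data.Nat.Base using (ℕ; zero; suc; _+_; _^_; ⌊_/2⌋)
open import Data.Bool.Base using (Bool; true; false; if_then_else_; T)
open import Data.Empty using (⊥)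
open import Data.Fin.Base using (Fin)
open import Data.Product using (Σ; _×_; ∃)
open import Data.Sum.Base using (_⊎_)
open import Relation.Binary.PropositionalEquality using (_≡_)
open import Function.Definitions using (Injective)

-- Hereditarily finite sets via the Ackermann coding:
-- the natural number s codes the set { x | bit x of s is 1 }.
-- Every natural number codes exactly one HF set and conversely,
-- so code equality is extensional set equality.

odd : ℕ → Bool
odd zero          = false
odd (suc zero)    = true
odd (suc (suc n)) = odd n

bit : ℕ → ℕ → Bool
bit zero    s = odd s
bit (suc x) s = bit x ⌊ s /2⌋

_∈ₕ_ : ℕ → ℕ → Set
x ∈ₕ s = T (bit x s)

∅ₕ : ℕ
∅ₕ = 0

adjoin : ℕ → ℕ → ℕ
adjoin x y = if bit y x then x else x + 2 ^ y

Family : Set₁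
Family = ℕ → Set

_⊆ₕ_ : ℕ → Family → Set
x ⊆ₕ S = ∀ z → z ∈ₕ x → S z

𝒫 : Family → Family
𝒫 S x = x ⊆ₕ S

_⊆_ : Family → Family → Set
S ⊆ T = ∀ x → S x → T x

HasCard : Family → ℕ → Set
HasCard S k = Σ (Fin k → ℕ) λ f →
  Injective _≡_ _≡_ f × (∀ i → S (f i)) × (∀ x → S x → ∃ λ i → f i ≡ x)

-- The minimally bounded adjunctive hierarchy.
-- Ab i  represents  Ā_{i-1}   (so Ab 0 = Ā_{-1} = ∅, Ab 1 = Ā_0 = {∅}).
--
-- Ā_{n+1} = {∅} ∪ { x ∪ {y} : x ∈ Ā_n, ∃ m ≥ -1, 𝒫(Ā_m) ⊆ Ā_n, y ∈ Ā_{m+1} }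
-- where (as required for the recursion to be well-founded) m + 1 ≤ n.
-- With j = m + 1:  Cond u i y  says  ∃ j < u, 𝒫(Ab j) ⊆ Ab i and Ab (suc j) y.

mutual
  Ab : ℕ → Family
  Ab zero          z = ⊥
  Ab (suc zero)    z = z ≡ ∅ₕ
  Ab (suc (suc k)) z =
    z ≡ ∅ₕ ⊎ Σ ℕ λ x → Σ ℕ λ y → z ≡ adjoin x y × Ab (suc k) x × Cond (suc k) (suc k) y

  Cond : ℕ → ℕ → ℕ → Set
  Cond zero    i y = ⊥
  Cond (suc u) i y = Cond u i y ⊎ ((𝒫 (Ab u) ⊆ Ab i) × Ab (suc u) y)

Ā : ℕ → Family
Ā n = Ab (suc n)

-- Write A = Ā_{n-1} and B = Ā_n, suppose Ā_c = 𝒫(A) with c = |A|, and let d = |B ∖ A|.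
-- By induction on k ≤ d, Ā_{c+k} consists of the subsets of B having at most k elements
-- outside A. At these levels the side condition 𝒫(Ā_m) ⊆ Ā_{c+k} holds for m = n-1 (as
-- 𝒫(A) = Ā_c is already present) and fails for m ≥ n (a subset of B with d > k elements
-- outside A is missing), so the elements that may be adjoined are exactly those of B.
-- At k = d the level is 𝒫(B), and c + d = |B|. Along the way one also carries finiteness,
-- n ≤ |Ā_{n-1}|, and strict growth of the hierarchy, which is what makes d positive.

module Submission where

open import Defs
open import Data.Bool.Base using (Bool; true; false; T; _∨_; if_then_else_)
open import Data.Bool.Properties using (T?; T-∨; ∨-zeroʳ; ∨-identityʳ)
open import Data.Empty using (⊥-elim)
open import Data.Fin.Base using (Fin; zero; suc)
open import Data.Nat.Base
open import Data.Nat.Properties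
open import Data.Nat.Induction using (<-rec)
open import Data.Product using (Σ; ∃; _×_; _,_; proj₁; proj₂; map₁; map₂′)
open import Data.Sum.Base using (_⊎_; inj₁; inj₂; [_,_]′; map₂)
open import Data.Unit.Base using (tt)
open import Function.Base using (id; _∘_)
open import Function.Bundles using (_⇔_; mk⇔; Equivalence)
open import Function.Properties.Equivalence using () renaming (sym to ⇔-sym; trans to ⇔-trans)
open import Function.Definitions using (Injective)
open import Relation.Nullary using (Dec; yes; no; does; ¬_; ¬?)
open import Relation.Nullary.Decidable using (map′; _×-dec_; _→-dec_)
open import Relation.Unary using (Decidable)
open import Relation.Binary.PropositionalEquality

-- Binary digits

twice : ℕ → ℕ
twice zero    = zero
twice (suc n) = suc (suc (twice n))

infixr 7 _∷ᵇ_

_∷ᵇ_ : Bool → ℕ → ℕ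
false ∷ᵇ h = twice h
true  ∷ᵇ h = suc (twice h)

odd-∷ᵇ : ∀ b h → odd (b ∷ᵇ h) ≡ b
odd-∷ᵇ false zero    = refl
odd-∷ᵇ false (suc h) = odd-∷ᵇ false h
odd-∷ᵇ true  zero    = refl
odd-∷ᵇ true  (suc h) = odd-∷ᵇ true h

⌊∷ᵇ/2⌋ : ∀ b h → ⌊ b ∷ᵇ h /2⌋ ≡ h
⌊∷ᵇ/2⌋ false zero    = refl
⌊∷ᵇ/2⌋ false (suc h) = cong suc (⌊∷ᵇ/2⌋ false h)
⌊∷ᵇ/2⌋ true  zero    = refl
⌊∷ᵇ/2⌋ true  (suc h) = cong suc (⌊∷ᵇ/2⌋ true h)

n≡odd∷ᵇ⌊n/2⌋ : ∀ n → n ≡ odd n ∷ᵇ ⌊ n /2⌋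
n≡odd∷ᵇ⌊n/2⌋ zero          = refl
n≡odd∷ᵇ⌊n/2⌋ (suc zero)    = refl
n≡odd∷ᵇ⌊n/2⌋ (suc (suc n)) with odd n | n≡odd∷ᵇ⌊n/2⌋ n
... | false | eq = cong (2 +_) eq
... | true  | eq = cong (2 +_) eq

bit-suc-∷ᵇ : ∀ z b h → bit (suc z) (b ∷ᵇ h) ≡ bit z h
bit-suc-∷ᵇ z b h = cong (bit z) (⌊∷ᵇ/2⌋ b h)

twice-+ : ∀ m n → twice (m + n) ≡ twice m + twice n
twice-+ zero    n = refl
twice-+ (suc m) n = cong (2 +_) (twice-+ m n)

2^suc≡twice : ∀ n → 2 ^ suc n ≡ twice (2 ^ n)
2^suc≡twice n = go (2 ^ n)
  where
  go : ∀ m → m + (m + 0) ≡ twice m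
  go zero    = refl
  go (suc m) = cong suc (trans (+-suc m (m + 0)) (cong suc (go m)))

∷ᵇ-+-twice : ∀ b h n → b ∷ᵇ h + twice n ≡ b ∷ᵇ (h + n)
∷ᵇ-+-twice false h n = sym (twice-+ h n)
∷ᵇ-+-twice true  h n = cong suc (sym (twice-+ h n))

twice-mono-≤ : ∀ {m n} → m ≤ n → twice m ≤ twice n
twice-mono-≤ z≤n       = z≤n
twice-mono-≤ (s≤s m≤n) = s≤s (s≤s (twice-mono-≤ m≤n))

bit-+-2^ : ∀ y x → bit y x ≡ false → ∀ z → bit z (x + 2 ^ y) ≡ bit z x ∨ (z ≡ᵇ y)
bit-+-2^ zero x x-even z = trans (cong (bit z) x+1≡) (digits z)
  where
  h = ⌊ x /2⌋
  x≡ : x ≡ false ∷ᵇ h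
  x≡ = trans (n≡odd∷ᵇ⌊n/2⌋ x) (cong (_∷ᵇ h) x-even)
  x+1≡ : x + 1 ≡ true ∷ᵇ h
  x+1≡ = trans (+-comm x 1) (cong suc x≡)
  digits : ∀ z → bit z (true ∷ᵇ h) ≡ bit z x ∨ (z ≡ᵇ 0)
  digits zero    = trans (odd-∷ᵇ true h) (sym (∨-zeroʳ (odd x)))
  digits (suc z) = trans (bit-suc-∷ᵇ z true h) (sym (∨-identityʳ (bit z h)))
bit-+-2^ (suc y) x bit-clear z = trans (cong (bit z) x+2^≡) (digits z)
  where
  b = odd x
  h = ⌊ x /2⌋
  x+2^≡ : x + 2 ^ suc y ≡ b ∷ᵇ (h + 2 ^ y)
  x+2^≡ = trans (cong₂ _+_ (n≡odd∷ᵇ⌊n/2⌋ x) (2^suc≡twice y)) (∷ᵇ-+-twice b h (2 ^ y))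
  digits : ∀ z → bit z (b ∷ᵇ (h + 2 ^ y)) ≡ bit z x ∨ (z ≡ᵇ suc y)
  digits zero    = trans (odd-∷ᵇ b (h + 2 ^ y)) (sym (∨-identityʳ b))
  digits (suc z) = trans (bit-suc-∷ᵇ z b (h + 2 ^ y)) (bit-+-2^ y h bit-clear z)

twice≤∷ᵇ : ∀ b h → twice h ≤ b ∷ᵇ h
twice≤∷ᵇ false h = ≤-refl
twice≤∷ᵇ true  h = n≤1+n (twice h)

∷ᵇ≤suc-twice : ∀ b h → b ∷ᵇ h ≤ suc (twice h)
∷ᵇ≤suc-twice false h = n≤1+n (twice h)
∷ᵇ≤suc-twice true  h = ≤-refl

n<2^n : ∀ n → n < 2 ^ n
n<2^n zero    = z<s
n<2^n (suc n) = ≤-trans (s≤s (n<2^n n)) (+-mono-≤ (m^n>0 2 n) (m≤m+n (2 ^ n) 0))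

-- Membership in Ackermann codes

_∈ₕ?_ : ∀ z s → Dec (z ∈ₕ s)
z ∈ₕ? s = T? (bit z s)

∉-∅ : ∀ z → ¬ z ∈ₕ ∅ₕ
∉-∅ zero    ()
∉-∅ (suc z) = ∉-∅ z

∅-unique : ∀ s → (∀ z → ¬ z ∈ₕ s) → s ≡ ∅ₕ
∅-unique = <-rec _ step
  where
  step : ∀ s → (∀ {h} → h < s → (∀ z → ¬ z ∈ₕ h) → h ≡ ∅ₕ) → (∀ z → ¬ z ∈ₕ s) → s ≡ ∅ₕ
  step zero    _  _     = refl
  step (suc s) ih empty with odd (suc s) in odd-s
  ... | true  = ⊥-elim (empty zero (subst T (sym odd-s) tt))
  ... | false = ⊥-elim (1+n≢0 (begin
      suc s                         ≡⟨ n≡odd∷ᵇ⌊n/2⌋ (suc s) ⟩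
      odd (suc s) ∷ᵇ ⌊ suc s /2⌋    ≡⟨ cong₂ _∷ᵇ_ odd-s half≡0 ⟩
      false ∷ᵇ 0                    ∎))
    where
    open ≡-Reasoning
    half≡0 : ⌊ suc s /2⌋ ≡ 0
    half≡0 = ih (⌊n/2⌋<n s) (λ z → empty (suc z))

∈-adjoin : ∀ {x y z} → z ∈ₕ adjoin x y ⇔ (z ∈ₕ x ⊎ z ≡ y)
∈-adjoin {x} {y} {z} with bit y x in y∈x
... | true  = mk⇔ inj₁ [ id , (λ { refl → subst T (sym y∈x) tt }) ]′
... | false = mk⇔ (λ z∈ → map₂ (≡ᵇ⇒≡ z y) (Equivalence.to T-∨ (subst T digits z∈)))
                  (λ z∈ → subst T (sym digits) (Equivalence.from T-∨ (map₂ (≡⇒≡ᵇ z y) z∈)))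
  where
  digits : bit z (x + 2 ^ y) ≡ bit z x ∨ (z ≡ᵇ y)
  digits = bit-+-2^ y x y∈x z

adjoin-≥ : ∀ x y → x ≤ adjoin x y
adjoin-≥ x y with bit y x
... | true  = ≤-refl
... | false = m≤m+n x (2 ^ y)

∈⇒≡+2^ : ∀ y s → y ∈ₕ s → ∃ λ x → bit y x ≡ false × s ≡ x + 2 ^ y
∈⇒≡+2^ zero s y∈s with odd s | n≡odd∷ᵇ⌊n/2⌋ s
... | true | s≡ = false ∷ᵇ ⌊ s /2⌋ , odd-∷ᵇ false ⌊ s /2⌋ , trans s≡ (+-comm 1 _)
∈⇒≡+2^ (suc y) s y∈s with ∈⇒≡+2^ y ⌊ s /2⌋ y∈s
... | x , clear , h≡ = odd s ∷ᵇ x , trans (bit-suc-∷ᵇ y (odd s) x) clear , (begin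
    s                             ≡⟨ n≡odd∷ᵇ⌊n/2⌋ s ⟩
    odd s ∷ᵇ ⌊ s /2⌋              ≡⟨ cong (odd s ∷ᵇ_) h≡ ⟩
    odd s ∷ᵇ (x + 2 ^ y)          ≡⟨ ∷ᵇ-+-twice (odd s) x (2 ^ y) ⟨
    odd s ∷ᵇ x + twice (2 ^ y)    ≡⟨ cong (odd s ∷ᵇ x +_) (2^suc≡twice y) ⟨
    odd s ∷ᵇ x + 2 ^ suc y        ∎)
  where open ≡-Reasoning

remove : ∀ {y s} → y ∈ₕ s → ∃ λ x → ¬ y ∈ₕ x × s ≡ adjoin x y
remove {y} {s} y∈s with ∈⇒≡+2^ y s y∈s
... | x , clear , s≡ = x , subst T clear , trans s≡ (cong (λ b → if b then x else x + 2 ^ y) (sym clear))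

∈⇒2^≤ : ∀ z s → z ∈ₕ s → 2 ^ z ≤ s
∈⇒2^≤ zero s z∈s with odd s | n≡odd∷ᵇ⌊n/2⌋ s
... | true | s≡ = subst (1 ≤_) (sym s≡) (s≤s z≤n)
∈⇒2^≤ (suc z) s z∈s = begin
  2 ^ suc z             ≡⟨ 2^suc≡twice z ⟩
  twice (2 ^ z)         ≤⟨ twice-mono-≤ (∈⇒2^≤ z ⌊ s /2⌋ z∈s) ⟩
  twice ⌊ s /2⌋         ≤⟨ twice≤∷ᵇ (odd s) ⌊ s /2⌋ ⟩
  odd s ∷ᵇ ⌊ s /2⌋      ≡⟨ n≡odd∷ᵇ⌊n/2⌋ s ⟨
  s                     ∎
  where open ≤-Reasoning

∈⇒< : ∀ {z s} → z ∈ₕ s → z < s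
∈⇒< {z} {s} z∈s = <-≤-trans (n<2^n z) (∈⇒2^≤ z s z∈s)

members-<⇒<2^ : ∀ N s → (∀ {z} → z ∈ₕ s → z < N) → s < 2 ^ N
members-<⇒<2^ zero    s bound = subst (_< 1) (sym (∅-unique s (λ z z∈s → n≮0 (bound {z} z∈s)))) z<s
members-<⇒<2^ (suc N) s bound = begin-strict
  s                     ≡⟨ n≡odd∷ᵇ⌊n/2⌋ s ⟩
  odd s ∷ᵇ ⌊ s /2⌋      ≤⟨ ∷ᵇ≤suc-twice (odd s) ⌊ s /2⌋ ⟩
  suc (twice ⌊ s /2⌋)   <⟨ n<1+n _ ⟩
  twice (suc ⌊ s /2⌋)   ≤⟨ twice-mono-≤ (members-<⇒<2^ N ⌊ s /2⌋ (λ {z} z∈ → ≤-pred (bound {suc z} z∈))) ⟩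
  twice (2 ^ N)         ≡⟨ 2^suc≡twice N ⟨
  2 ^ suc N             ∎
  where open ≤-Reasoning

-- Counting below a bound

count : {P : Family} → Decidable P → ℕ → ℕ
count P? zero    = zero
count P? (suc n) = if does (P? n) then suc (count P? n) else count P? n

setBelow : {P : Family} → Decidable P → ℕ → ℕ
setBelow P? zero    = ∅ₕ
setBelow P? (suc n) = if does (P? n) then adjoin (setBelow P? n) n else setBelow P? n

module _ {P : Family} (P? : Decidable P) where

  count-suc-≤ : ∀ n → count P? (suc n) ≤ suc (count P? n)
  count-suc-≤ n with P? n
  ... | yes _ = ≤-refl
  ... | no  _ = n≤1+n (count P? n)

  count-none : ∀ N → (∀ {x} → x < N → ¬ P x) → count P? N ≡ 0
  count-none zero    _    = refl
  count-none (suc N) none with P? N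
  ... | yes pN = ⊥-elim (none ≤-refl pN)
  ... | no  _  = count-none N (λ x<N → none (m≤n⇒m≤1+n x<N))

  count-beyond : ∀ {N M} → (∀ {x} → P x → x < N) → N ≤ M → count P? M ≡ count P? N
  count-beyond {N} {zero}  _     z≤n  = refl
  count-beyond {N} {suc M} bound N≤1+M with m≤n⇒m<n∨m≡n N≤1+M
  ... | inj₂ refl = refl
  ... | inj₁ N<1+M with P? M
  ...   | yes pM = ⊥-elim (<⇒≱ (bound pM) (≤-pred N<1+M))
  ...   | no  _  = count-beyond bound (≤-pred N<1+M)

  count-bound-irrelevant : ∀ {N M} → (∀ {x} → P x → x < N) → (∀ {x} → P x → x < M) →
                           count P? N ≡ count P? M
  count-bound-irrelevant {N} {M} <N <M =
    trans (sym (count-beyond <N (m≤m⊔n N M))) (count-beyond <M (m≤n⊔m N M))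

  count-pos⇒witness : ∀ N → 0 < count P? N → ∃ λ x → x < N × P x
  count-pos⇒witness (suc N) pos with P? N
  ... | yes pN = N , ≤-refl , pN
  ... | no  _  with count-pos⇒witness N pos
  ...   | x , x<N , px = x , m≤n⇒m≤1+n x<N , px

  witness⇒count-pos : ∀ {x N} → P x → x < N → 0 < count P? N
  witness⇒count-pos {x} {suc N} px x<1+N with P? N
  ... | yes _  = z<s
  ... | no ¬pN with m<1+n⇒m<n∨m≡n x<1+N
  ...   | inj₁ x<N  = witness⇒count-pos px x<N
  ...   | inj₂ refl = ⊥-elim (¬pN px)

  count-intermediate : ∀ N {m} → m ≤ count P? N → ∃ λ M → count P? M ≡ m
  count-intermediate zero    z≤n = zero , refl
  count-intermediate (suc N) {m} m≤ with m ≟ count P? (suc N)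
  ... | yes m≡ = suc N , sym m≡
  ... | no  m≢ = count-intermediate N (≤-pred (≤-trans (≤∧≢⇒< m≤ m≢) (count-suc-≤ N)))

  ∈-setBelow : ∀ N {z} → z ∈ₕ setBelow P? N ⇔ (z < N × P z)
  ∈-setBelow zero    {z} = mk⇔ (λ z∈∅ → ⊥-elim (∉-∅ z z∈∅)) (λ { (() , _) })
  ∈-setBelow (suc N) {z} with P? N
  ... | yes pN = mk⇔ to from
    where
    to : z ∈ₕ adjoin (setBelow P? N) N → z < suc N × P z
    to z∈ with Equivalence.to (∈-adjoin {setBelow P? N} {N} {z}) z∈
    ... | inj₁ z∈′ = map₁ m≤n⇒m≤1+n (Equivalence.to (∈-setBelow N) z∈′)
    ... | inj₂ refl = ≤-refl , pN
    from : z < suc N × P z → z ∈ₕ adjoin (setBelow P? N) N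
    from (z<1+N , pz) with m<1+n⇒m<n∨m≡n z<1+N
    ... | inj₁ z<N  = Equivalence.from (∈-adjoin {setBelow P? N} {N} {z})
                        (inj₁ (Equivalence.from (∈-setBelow N) (z<N , pz)))
    ... | inj₂ refl = Equivalence.from (∈-adjoin {setBelow P? N} {N} {z}) (inj₂ refl)
  ... | no ¬pN = mk⇔ (λ z∈ → map₁ m≤n⇒m≤1+n (Equivalence.to (∈-setBelow N) z∈)) from
    where
    from : z < suc N × P z → z ∈ₕ setBelow P? N
    from (z<1+N , pz) with m<1+n⇒m<n∨m≡n z<1+N
    ... | inj₁ z<N  = Equivalence.from (∈-setBelow N) (z<N , pz)
    ... | inj₂ refl = ⊥-elim (¬pN pz)

module _ {P Q : Family} (P? : Decidable P) (Q? : Decidable Q) where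

  count-mono : ∀ N → (∀ {x} → x < N → P x → Q x) → count P? N ≤ count Q? N
  count-mono zero    _   = z≤n
  count-mono (suc N) P⊆Q with P? N | Q? N
  ... | yes _  | yes _  = s≤s (count-mono N (λ x<N → P⊆Q (m≤n⇒m≤1+n x<N)))
  ... | yes pN | no ¬qN = ⊥-elim (¬qN (P⊆Q ≤-refl pN))
  ... | no  _  | yes _  = m≤n⇒m≤1+n (count-mono N (λ x<N → P⊆Q (m≤n⇒m≤1+n x<N)))
  ... | no  _  | no  _  = count-mono N (λ x<N → P⊆Q (m≤n⇒m≤1+n x<N))

module _ {P Q : Family} (P? : Decidable P) (Q? : Decidable Q) where

  count-cong : ∀ N → (∀ {x} → x < N → P x ⇔ Q x) → count P? N ≡ count Q? N
  count-cong N P⇔Q = ≤-antisym (count-mono P? Q? N (λ x<N → Equivalence.to (P⇔Q x<N)))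
                               (count-mono Q? P? N (λ x<N → Equivalence.from (P⇔Q x<N)))

  count-insert : ∀ {y} N → (∀ {x} → Q x → P x ⊎ x ≡ y) → count Q? N ≤ suc (count P? N)
  count-insert zero    _      = z≤n
  count-insert {y} (suc N) Q⊆P+y with Q? N | P? N
  ... | yes _  | yes _  = s≤s (count-insert N Q⊆P+y)
  ... | yes qN | no ¬pN = s≤s (count-mono Q? P? N Q⊆P)
    where
    Q⊆P : ∀ {x} → x < N → Q x → P x
    Q⊆P {x} x<N qx with Q⊆P+y qx | Q⊆P+y qN
    ... | inj₁ px   | _         = px
    ... | inj₂ refl | inj₁ pN   = ⊥-elim (¬pN pN)
    ... | inj₂ refl | inj₂ refl = ⊥-elim (<-irrefl refl x<N)
  ... | no  _  | yes _  = m≤n⇒m≤1+n (count-insert N Q⊆P+y)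
  ... | no  _  | no  _  = count-insert N Q⊆P+y

  count-< : ∀ {y} N → (∀ {x} → P x → Q x) → Q y → ¬ P y → y < N → count P? N < count Q? N
  count-< {y} (suc N) P⊆Q qy ¬py y<1+N with m<1+n⇒m<n∨m≡n y<1+N | P? N | Q? N
  ... | _         | yes pN | no ¬qN = ⊥-elim (¬qN (P⊆Q pN))
  ... | inj₂ refl | yes pN | _      = ⊥-elim (¬py pN)
  ... | inj₂ refl | no  _  | no ¬qN = ⊥-elim (¬qN qy)
  ... | inj₂ refl | no  _  | yes _  = s≤s (count-mono P? Q? N (λ _ → P⊆Q))
  ... | inj₁ y<N  | yes _  | yes _  = s≤s (count-< N P⊆Q qy ¬py y<N)
  ... | inj₁ y<N  | no  _  | yes _  = m≤n⇒m≤1+n (count-< N P⊆Q qy ¬py y<N)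
  ... | inj₁ y<N  | no  _  | no  _  = count-< N P⊆Q qy ¬py y<N

  count-∖ : ∀ N → (∀ {x} → P x → Q x) →
            count Q? N ≡ count P? N + count (λ x → Q? x ×-dec ¬? (P? x)) N
  count-∖ zero    _   = refl
  count-∖ (suc N) P⊆Q with P? N | Q? N
  ... | yes _  | yes _  = cong suc (count-∖ N P⊆Q)
  ... | yes pN | no ¬qN = ⊥-elim (¬qN (P⊆Q pN))
  ... | no  _  | yes _  = trans (cong suc (count-∖ N P⊆Q)) (sym (+-suc _ _))
  ... | no  _  | no  _  = count-∖ N P⊆Q

module _ {P : Family} (P? : Decidable P) where

  enumerate : ∀ N → Σ (Fin (count P? N) → ℕ) λ f →
              Injective _≡_ _≡_ f × (∀ i → P (f i) × f i < N) × (∀ {x} → P x → x < N → ∃ λ i → f i ≡ x)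
  enumerate zero = (λ ()) , (λ {}) , (λ ()) , (λ _ ())
  enumerate (suc N) with P? N | enumerate N
  ... | no ¬pN | f , f-inj , f-mem , f-onto = f , f-inj , f-mem′ , f-onto′
    where
    f-mem′ : ∀ i → P (f i) × f i < suc N
    f-mem′ i = map₂′ m≤n⇒m≤1+n (f-mem i)
    f-onto′ : ∀ {x} → P x → x < suc N → ∃ λ i → f i ≡ x
    f-onto′ px x<1+N with m<1+n⇒m<n∨m≡n x<1+N
    ... | inj₁ x<N  = f-onto px x<N
    ... | inj₂ refl = ⊥-elim (¬pN px)
  ... | yes pN | f , f-inj , f-mem , f-onto = g , g-inj , g-mem , g-onto
    where
    g : Fin (suc (count P? N)) → ℕ
    g zero    = N
    g (suc i) = f i
    g-inj : Injective _≡_ _≡_ g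
    g-inj {zero}  {zero}  _  = refl
    g-inj {zero}  {suc j} eq = ⊥-elim (<-irrefl (sym eq) (proj₂ (f-mem j)))
    g-inj {suc i} {zero}  eq = ⊥-elim (<-irrefl eq (proj₂ (f-mem i)))
    g-inj {suc i} {suc j} eq = cong suc (f-inj eq)
    g-mem : ∀ i → P (g i) × g i < suc N
    g-mem zero    = pN , ≤-refl
    g-mem (suc i) = map₂′ m≤n⇒m≤1+n (f-mem i)
    g-onto : ∀ {x} → P x → x < suc N → ∃ λ i → g i ≡ x
    g-onto px x<1+N with m<1+n⇒m<n∨m≡n x<1+N
    ... | inj₂ refl = zero , refl
    ... | inj₁ x<N  with f-onto px x<N
    ...   | i , fi≡x = suc i , fi≡x

record Finite (P : Family) : Set where
  field
    bound   : ℕ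
    <-bound : ∀ {x} → P x → x < bound
    decide  : Decidable P

open Finite public

card : ∀ {P} → Finite P → ℕ
card F = count (decide F) (bound F)

module _ {P Q : Family} (F : Finite P) (P⇔Q : ∀ x → P x ⇔ Q x) where

  Finite-cong : Finite Q
  Finite-cong = record
    { bound   = bound F
    ; <-bound = λ {x} qx → <-bound F (Equivalence.from (P⇔Q x) qx)
    ; decide  = λ x → map′ (Equivalence.to (P⇔Q x)) (Equivalence.from (P⇔Q x)) (decide F x)
    }

  card-cong : (G : Finite Q) → card F ≡ card G
  card-cong G = trans (count-cong (decide F) (decide G) (bound F) (λ {x} _ → P⇔Q x))
                      (count-bound-irrelevant (decide G) (λ {x} qx → <-bound F (Equivalence.from (P⇔Q x) qx))
                                                         (<-bound G))

Finite⇒HasCard : ∀ {P} (F : Finite P) → HasCard P (card F)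
Finite⇒HasCard F with enumerate (decide F) (bound F)
... | f , f-inj , f-mem , f-onto = f , f-inj , (λ i → proj₁ (f-mem i)) , (λ x px → f-onto px (<-bound F px))

-- Subsets of B with a bounded number of elements outside A

outside? : {A : Family} → Decidable A → (s : ℕ) → Decidable (λ z → z ∈ₕ s × ¬ A z)
outside? A? s z = z ∈ₕ? s ×-dec ¬? (A? z)

∣_∖_∣ : {A : Family} → ℕ → Decidable A → ℕ
∣ s ∖ A? ∣ = count (outside? A? s) s

∣∖∣≡count : ∀ {A} (A? : Decidable A) {s N} → s ≤ N → ∣ s ∖ A? ∣ ≡ count (outside? A? s) N
∣∖∣≡count A? {s} s≤N = sym (count-beyond (outside? A? s) (λ o → ∈⇒< (proj₁ o)) s≤N)

𝒫? : {S : Family} → Decidable S → Decidable (𝒫 S)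
𝒫? S? s = map′ (λ h z z∈s → h (∈⇒< z∈s) z∈s) (λ h {z} _ → h z)
               (allUpTo? (λ z → (z ∈ₕ? s) →-dec S? z) s)

module Layers {A B : Family} (FA : Finite A) (FB : Finite B) (A⊆B : A ⊆ B) where

  private
    A? : Decidable A
    A? = decide FA

  B∖A? : Decidable (λ z → B z × ¬ A z)
  B∖A? z = decide FB z ×-dec ¬? (A? z)

  gap : ℕ
  gap = count B∖A? (bound FB)

  Layer : ℕ → Family
  Layer k s = 𝒫 B s × ∣ s ∖ A? ∣ ≤ k

  layer-∅ : ∀ k → Layer k ∅ₕ
  layer-∅ k = (λ z z∈∅ → ⊥-elim (∉-∅ z z∈∅)) , z≤n

  layer-zero : ∀ s → Layer 0 s ⇔ 𝒫 A s
  layer-zero s = mk⇔ to (λ s⊆A → (λ z z∈s → A⊆B z (s⊆A z z∈s)) , ≤-reflexive (none s⊆A))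
    where
    to : Layer 0 s → 𝒫 A s
    to (_ , ∣s∣≤0) z z∈s with A? z
    ... | yes Az = Az
    ... | no ¬Az = ⊥-elim (<⇒≱ (witness⇒count-pos (outside? A? s) (z∈s , ¬Az) (∈⇒< z∈s)) ∣s∣≤0)
    none : 𝒫 A s → ∣ s ∖ A? ∣ ≡ 0
    none s⊆A = count-none (outside? A? s) s (λ _ o → proj₂ o (s⊆A _ (proj₁ o)))

  layer-adjoin : ∀ {k x y} → Layer k x → B y → Layer (suc k) (adjoin x y)
  layer-adjoin {k} {x} {y} (x⊆B , ∣x∣≤k) By = s⊆B , (begin
    ∣ s ∖ A? ∣                     ≤⟨ count-insert (outside? A? x) (outside? A? s) s s⊆x+y ⟩
    suc (count (outside? A? x) s)  ≡⟨ cong suc (∣∖∣≡count A? (adjoin-≥ x y)) ⟨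
    suc ∣ x ∖ A? ∣                 ≤⟨ s≤s ∣x∣≤k ⟩
    suc k                          ∎)
    where
    open ≤-Reasoning
    s : ℕ
    s = adjoin x y
    s⊆B : 𝒫 B s
    s⊆B z z∈s = [ x⊆B z , (λ { refl → By }) ]′ (Equivalence.to (∈-adjoin {x} {y} {z}) z∈s)
    s⊆x+y : ∀ {z} → z ∈ₕ s × ¬ A z → (z ∈ₕ x × ¬ A z) ⊎ z ≡ y
    s⊆x+y {z} (z∈s , ¬Az) = [ (λ z∈x → inj₁ (z∈x , ¬Az)) , inj₂ ]′ (Equivalence.to (∈-adjoin {x} {y} {z}) z∈s)

  layer-split : ∀ {k s} → Layer (suc k) s →
                Layer k s ⊎ ∃ λ x → ∃ λ y → s ≡ adjoin x y × Layer k x × B y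
  layer-split {k} {s} (s⊆B , ∣s∣≤1+k) with ∣ s ∖ A? ∣ ≤? k
  ... | yes ∣s∣≤k = inj₁ (s⊆B , ∣s∣≤k)
  ... | no  ∣s∣≰k with count-pos⇒witness (outside? A? s) s (≤-trans (s≤s z≤n) (≰⇒> ∣s∣≰k))
  ...   | y , _ , y∈s , ¬Ay with remove {y} {s} y∈s
  ...     | x , y∉x , s≡x+y = inj₂ (x , y , s≡x+y , ((λ z z∈x → s⊆B z (x⊆s z z∈x)) , ∣x∣≤k) , s⊆B y y∈s)
    where
    open ≤-Reasoning
    x⊆s : ∀ z → z ∈ₕ x → z ∈ₕ s
    x⊆s z z∈x = subst (z ∈ₕ_) (sym s≡x+y) (Equivalence.from (∈-adjoin {x} {y} {z}) (inj₁ z∈x))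
    y-counted-only-in-s : count (outside? A? x) s < ∣ s ∖ A? ∣
    y-counted-only-in-s = count-< (outside? A? x) (outside? A? s) {y} s (λ {z} → map₁ (x⊆s z))
                            (y∈s , ¬Ay) (y∉x ∘ proj₁) (∈⇒< {y} y∈s)
    ∣x∣≤k : ∣ x ∖ A? ∣ ≤ k
    ∣x∣≤k = ≤-pred (begin-strict
      ∣ x ∖ A? ∣                 ≡⟨ ∣∖∣≡count A? (subst (x ≤_) (sym s≡x+y) (adjoin-≥ x y)) ⟩
      count (outside? A? x) s    <⟨ y-counted-only-in-s ⟩
      ∣ s ∖ A? ∣                 ≤⟨ ∣s∣≤1+k ⟩
      suc k                      ∎)

  layer-top : ∀ {s} → 𝒫 B s → Layer gap s
  layer-top {s} s⊆B = s⊆B , (begin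
    ∣ s ∖ A? ∣                        ≡⟨ ∣∖∣≡count A? (m≤m⊔n s (bound FB)) ⟩
    count (outside? A? s) M           ≤⟨ count-mono (outside? A? s) B∖A? M (λ _ o → s⊆B _ (proj₁ o) , proj₂ o) ⟩
    count B∖A? M                      ≡⟨ count-beyond B∖A? (λ o → <-bound FB (proj₁ o)) (m≤n⊔m s (bound FB)) ⟩
    gap                               ∎)
    where
    open ≤-Reasoning
    M : ℕ
    M = s ⊔ bound FB

  layer-exact : ∀ {m} → m ≤ gap → ∃ λ s → 𝒫 B s × ∣ s ∖ A? ∣ ≡ m
  layer-exact m≤gap with count-intermediate B∖A? (bound FB) m≤gap
  ... | M , count≡m = s , (λ z z∈s → proj₁ (proj₂ (members z∈s))) , (begin
    ∣ s ∖ A? ∣                ≡⟨ count-bound-irrelevant (outside? A? s) (λ o → ∈⇒< (proj₁ o))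
                                                                    (λ o → proj₁ (members (proj₁ o))) ⟩
    count (outside? A? s) M   ≡⟨ count-cong (outside? A? s) B∖A? M s∖A⇔B∖A ⟩
    count B∖A? M              ≡⟨ count≡m ⟩
    _                         ∎)
    where
    open ≡-Reasoning
    s : ℕ
    s = setBelow B∖A? M
    members : ∀ {z} → z ∈ₕ s → z < M × B z × ¬ A z
    members = Equivalence.to (∈-setBelow B∖A? M)
    s∖A⇔B∖A : ∀ {z} → z < M → (z ∈ₕ s × ¬ A z) ⇔ (B z × ¬ A z)
    s∖A⇔B∖A z<M = mk⇔ (λ o → proj₂ (members (proj₁ o)))
                      (λ z∈B∖A → Equivalence.from (∈-setBelow B∖A? M) (z<M , z∈B∖A) , proj₂ z∈B∖A)

  layer-finite : ∀ k → Finite (Layer k)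
  layer-finite k = record
    { bound   = 2 ^ bound FB
    ; <-bound = λ {s} L → members-<⇒<2^ (bound FB) s (λ {z} z∈s → <-bound FB (proj₁ L z z∈s))
    ; decide  = λ s → 𝒫? (decide FB) s ×-dec (∣ s ∖ A? ∣ ≤? k)
    }

  card≡card+gap : card FB ≡ card FA + gap
  card≡card+gap = begin
    card FB                                         ≡⟨ count-∖ A? (decide FB) (bound FB) (A⊆B _) ⟩
    count A? (bound FB) + gap                       ≡⟨ cong (_+ gap) (count-bound-irrelevant A?
                                                         (λ a → <-bound FB (A⊆B _ a)) (<-bound FA)) ⟩
    card FA + gap                                   ∎
    where open ≡-Reasoning

  gap-pos : ∀ {x} → B x → ¬ A x → 0 < gap
  gap-pos Bx ¬Ax = witness⇒count-pos B∖A? (Bx , ¬Ax) (<-bound FB Bx)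

-- The hierarchy

Cond⇒level : ∀ u {i y} → Cond u i y → ∃ λ j → j < u × 𝒫 (Ab j) ⊆ Ab i × Ab (suc j) y
Cond⇒level (suc u) (inj₂ (𝒫⊆ , y∈)) = u , ≤-refl , 𝒫⊆ , y∈
Cond⇒level (suc u) (inj₁ cond) with Cond⇒level u cond
... | j , j<u , 𝒫⊆ , y∈ = j , m≤n⇒m≤1+n j<u , 𝒫⊆ , y∈

level⇒Cond : ∀ u {i j y} → j < u → 𝒫 (Ab j) ⊆ Ab i → Ab (suc j) y → Cond u i y
level⇒Cond (suc u) j<1+u 𝒫⊆ y∈ with m<1+n⇒m<n∨m≡n j<1+u
... | inj₁ j<u  = inj₁ (level⇒Cond u j<u 𝒫⊆ y∈)
... | inj₂ refl = inj₂ (𝒫⊆ , y∈)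

Cond-mono : ∀ u {i i′ y} → Ab i ⊆ Ab i′ → Cond u i y → Cond u i′ y
Cond-mono (suc u) i⊆i′ (inj₁ cond)       = inj₁ (Cond-mono u i⊆i′ cond)
Cond-mono (suc u) i⊆i′ (inj₂ (𝒫⊆ , y∈)) = inj₂ ((λ x x∈ → i⊆i′ x (𝒫⊆ x x∈)) , y∈)

Ab-⊆-suc : ∀ t → Ab t ⊆ Ab (suc t)
Ab-⊆-suc zero          _ ()
Ab-⊆-suc (suc zero)    _ z≡∅ = inj₁ z≡∅
Ab-⊆-suc (suc (suc t)) _ (inj₁ z≡∅) = inj₁ z≡∅
Ab-⊆-suc (suc (suc t)) _ (inj₂ (x , y , z≡ , x∈ , cond)) =
  inj₂ (x , y , z≡ , Ab-⊆-suc (suc t) x x∈ , inj₁ (Cond-mono (suc t) (Ab-⊆-suc (suc t)) cond))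

Ab-mono : ∀ {t t′} → t ≤ t′ → Ab t ⊆ Ab t′
Ab-mono {t} {zero}   z≤n     = λ _ z∈ → z∈
Ab-mono {t} {suc t′} t≤1+t′ with m≤n⇒m<n∨m≡n t≤1+t′
... | inj₂ refl  = λ _ z∈ → z∈
... | inj₁ t<1+t′ = λ z z∈ → Ab-⊆-suc t′ z (Ab-mono (≤-pred t<1+t′) z z∈)

module Step (p c : ℕ) (p≤c : p ≤ c) (Fp : Finite (Ab p)) (Fq : Finite (Ab (suc p)))
            (powerset : ∀ x → Ab (suc c) x ⇔ 𝒫 (Ab p) x) where

  open Layers Fp Fq (Ab-⊆-suc p) public

  admissible : ∀ {k} → k < gap → (∀ x → Ab (suc (k + c)) x ⇔ Layer k x) →
               ∀ y → Cond (suc (k + c)) (suc (k + c)) y ⇔ Ab (suc p) y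
  admissible {k} k<gap layer-k y = mk⇔ to from
    where
    -- for j > p, 𝒫 (Ab j) contains a subset of B with gap > k elements outside A
    j≤p : ∀ {j} → 𝒫 (Ab j) ⊆ Ab (suc (k + c)) → j ≤ p
    j≤p {j} 𝒫⊆ with j ≤? p | layer-exact ≤-refl
    ... | yes j≤p | _ = j≤p
    ... | no  j≰p | s , s⊆B , ∣s∣≡gap = ⊥-elim (<⇒≱ k<gap (subst (_≤ k) ∣s∣≡gap (proj₂ s∈layer-k)))
      where
      s∈layer-k : Layer k s
      s∈layer-k = Equivalence.to (layer-k s) (𝒫⊆ s (λ z z∈s → Ab-mono (≰⇒> j≰p) z (s⊆B z z∈s)))
    to : Cond (suc (k + c)) (suc (k + c)) y → Ab (suc p) y
    to cond with Cond⇒level (suc (k + c)) cond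
    ... | j , _ , 𝒫⊆ , y∈ = Ab-mono (s≤s (j≤p 𝒫⊆)) y y∈
    from : Ab (suc p) y → Cond (suc (k + c)) (suc (k + c)) y
    from = level⇒Cond (suc (k + c)) (s≤s (≤-trans p≤c (m≤n+m c k)))
             (λ x x⊆ → Ab-mono (s≤s (m≤n+m c k)) x (Equivalence.from (powerset x) x⊆))

  layer : ∀ k → k ≤ gap → ∀ s → Ab (suc (k + c)) s ⇔ Layer k s
  layer zero    _      s = ⇔-trans (powerset s) (⇔-sym (layer-zero s))
  layer (suc k) 1+k≤gap s = mk⇔ to from
    where
    layer-k : ∀ x → Ab (suc (k + c)) x ⇔ Layer k x
    layer-k = layer k (≤-trans (n≤1+n k) 1+k≤gap)
    admissible-k : ∀ y → Cond (suc (k + c)) (suc (k + c)) y ⇔ Ab (suc p) y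
    admissible-k = admissible 1+k≤gap layer-k
    to : Ab (suc (suc (k + c))) s → Layer (suc k) s
    to (inj₁ refl) = layer-∅ (suc k)
    to (inj₂ (x , y , refl , x∈ , cond)) =
      layer-adjoin (Equivalence.to (layer-k x) x∈) (Equivalence.to (admissible-k y) cond)
    from : Layer (suc k) s → Ab (suc (suc (k + c))) s
    from s∈ with layer-split s∈
    ... | inj₁ s∈layer-k = Ab-⊆-suc (suc (k + c)) s (Equivalence.from (layer-k s) s∈layer-k)
    ... | inj₂ (x , y , s≡ , x∈ , y∈) =
      inj₂ (x , y , s≡ , Equivalence.from (layer-k x) x∈ , Equivalence.from (admissible-k y) y∈)

-- Stage p concerns Ā_{p-1} = Ab p, and size is a_{p-1}.
record Stage (p : ℕ) : Set where
  field
    size      : ℕ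
    p≤size    : p ≤ size
    finite    : ∀ {t} → t ≤ suc size → Finite (Ab t)
    card≡size : (F : Finite (Ab p)) → card F ≡ size
    powerset  : ∀ x → Ab (suc size) x ⇔ 𝒫 (Ab p) x
    strict    : ∀ {t} → t ≤ size → ∃ λ x → Ab (suc t) x × ¬ Ab t x

stage-zero : Stage 0
stage-zero = record
  { size      = 0
  ; p≤size    = z≤n
  ; finite    = finite
  ; card≡size = λ F → count-none (decide F) (bound F) (λ _ ())
  ; powerset  = λ x → mk⇔ (λ { refl z z∈∅ → ∉-∅ z z∈∅ }) (∅-unique x)
  ; strict    = λ { {zero} _ → ∅ₕ , refl , λ () }
  }
  where
  finite : ∀ {t} → t ≤ 1 → Finite (Ab t)
  finite {zero}        _ = record { bound = 0 ; <-bound = λ () ; decide = λ _ → no λ () }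
  finite {suc zero}    _ = record { bound = 1 ; <-bound = λ { refl → z<s } ; decide = _≟ 0 }
  finite {suc (suc t)} (s≤s ())

stage-suc : ∀ {p} → Stage p → Stage (suc p)
stage-suc {p} S = record
  { size      = gap + c
  ; p≤size    = +-mono-≤ 0<gap p≤c
  ; finite    = finite′
  ; card≡size = card≡gap+c
  ; powerset  = λ x → mk⇔ (proj₁ ∘ Equivalence.to (layer gap ≤-refl x))
                           (Equivalence.from (layer gap ≤-refl x) ∘ layer-top)
  ; strict    = strict′
  }
  where
  open Stage S renaming (size to c; p≤size to p≤c)
  Fp : Finite (Ab p)
  Fp = finite (m≤n⇒m≤1+n p≤c)
  Fq : Finite (Ab (suc p))
  Fq = finite (s≤s p≤c)
  open Step p c p≤c Fp Fq powerset
  card≡gap+c : (F : Finite (Ab (suc p))) → card F ≡ gap + c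
  card≡gap+c F = begin
    card F         ≡⟨ card-cong F (λ _ → mk⇔ id id) Fq ⟩
    card Fq        ≡⟨ card≡card+gap ⟩
    card Fp + gap  ≡⟨ cong (_+ gap) (card≡size Fp) ⟩
    c + gap        ≡⟨ +-comm c gap ⟩
    gap + c        ∎
    where open ≡-Reasoning
  0<gap : 0 < gap
  0<gap with strict p≤c
  ... | x , x∈ , x∉ = gap-pos x∈ x∉
  above : ∀ {t} → c < t → ∃ λ k → t ≡ suc (k + c)
  above c<t with m≤n⇒∃[o]m+o≡n c<t
  ... | k , c+k≡t = k , trans (sym c+k≡t) (cong suc (+-comm c k))
  finite′ : ∀ {t} → t ≤ suc (gap + c) → Finite (Ab t)
  finite′ {t} t≤ with t ≤? suc c
  ... | yes t≤1+c = finite t≤1+c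
  ... | no  t≰1+c with above (≤-trans (n≤1+n _) (≰⇒> t≰1+c))
  ...   | k , refl = Finite-cong (layer-finite k) (λ s → ⇔-sym (layer k (+-cancelʳ-≤ c k gap (≤-pred t≤)) s))
  strict′ : ∀ {t} → t ≤ gap + c → ∃ λ x → Ab (suc t) x × ¬ Ab t x
  strict′ {t} t≤ with t ≤? c
  ... | yes t≤c = strict t≤c
  ... | no  t≰c with above (≰⇒> t≰c)
  ...   | k , refl with layer-exact (+-cancelʳ-≤ c (suc k) gap t≤)
  ...     | s , s⊆B , ∣s∣≡1+k =
    s , Equivalence.from (layer (suc k) 1+k≤gap s) (s⊆B , ≤-reflexive ∣s∣≡1+k) , s∉
    where
    1+k≤gap : suc k ≤ gap
    1+k≤gap = +-cancelʳ-≤ c (suc k) gap t≤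
    s∉ : ¬ Ab (suc (k + c)) s
    s∉ s∈ = 1+n≰n (subst (_≤ k) ∣s∣≡1+k
                     (proj₂ (Equivalence.to (layer k (≤-trans (n≤1+n k) 1+k≤gap) s) s∈)))

stage : ∀ p → Stage p
stage zero    = stage-zero
stage (suc p) = stage-suc (stage p)

lemma3 : (n : ℕ) → Σ ℕ λ a → HasCard (Ā n) a × (∀ x → Ā a x ⇔ 𝒫 (Ā n) x)
lemma3 n = size , subst (HasCard (Ā n)) (card≡size F) (Finite⇒HasCard F) , powerset
  where
  open Stage (stage (suc n))
  F : Finite (Ā n)
  F = finite (m≤n⇒m≤1+n p≤size)
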